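{- For every even integer $m\ge 4$ there exist a bipartite graph $G$ and a (not necessarily proper) colouring of the edges of $G$ with $m+1$ colours such that every colour appears on exactly $m$ edges, the maximum degree of $G$ is $m/2+1$ (so every colour appears on at least $\Delta(G)+1$ edges), and $G$ has no full rainbow matching.
   Context: A full rainbow matching in an edge-coloured graph is a matching (set of pairwise vertex-disjoint edges) containing exactly one edge of each colour used in the colouring. -}

module Defs where

open import Data.Nat using (ℕ; zero; suc; _+_; _≤_)
open import Data.Fin using (Fin; zero; suc; _≟_)
open import Data.Bool using (Bool; true; false; if_then_else_; _∨_)
open import Data.Product using (Σ; _×_; _,_; proj₁; proj₂)
open import Data.Sum using (_⊎_)
open import Relation.Nullary using (¬_)
open import Relation.Nullary.Decidable using (⌊_⌋)
open import Relation.Binary.PropositionalEquality using (_≡_; _≢_)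

count : ∀ {n} → (Fin n → Bool) → ℕ
count {zero}  p = 0
count {suc n} p = (if p zero then 1 else 0) + count (λ i → p (suc i))

EdgeList : ℕ → ℕ → Set
EdgeList n e = Fin e → Fin n × Fin n

SamePair : ∀ {n} → Fin n × Fin n → Fin n × Fin n → Set
SamePair (u , v) (u' , v') = (u ≡ u' × v ≡ v') ⊎ (u ≡ v' × v ≡ u')

IsSimple : ∀ {n e} → EdgeList n e → Set
IsSimple {n} {e} E =
  (∀ i → proj₁ (E i) ≢ proj₂ (E i)) ×
  (∀ i j → SamePair (E i) (E j) → i ≡ j)

IsBipartite : ∀ {n e} → EdgeList n e → Set
IsBipartite {n} {e} E =
  Σ (Fin n → Bool) λ side → ∀ i → side (proj₁ (E i)) ≢ side (proj₂ (E i))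

incident : ∀ {n e} → EdgeList n e → Fin n → Fin e → Bool
incident E v i = ⌊ proj₁ (E i) ≟ v ⌋ ∨ ⌊ proj₂ (E i) ≟ v ⌋

degree : ∀ {n e} → EdgeList n e → Fin n → ℕ
degree E v = count (incident E v)

MaxDegree : ∀ {n e} → EdgeList n e → ℕ → Set
MaxDegree {n} E d = (∀ v → degree E v ≤ d) × Σ (Fin n) λ v → degree E v ≡ d

colourCount : ∀ {e k} → (Fin e → Fin k) → Fin k → ℕ
colourCount c k = count (λ i → ⌊ c i ≟ k ⌋)

Disjoint : ∀ {n e} → EdgeList n e → Fin e → Fin e → Set
Disjoint E i j =
  ∀ v → incident E v i ≡ true → incident E v j ≡ false

FullRainbowMatching : ∀ {n e k} → EdgeList n e → (Fin e → Fin k) → Set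
FullRainbowMatching {n} {e} {k} E c =
  Σ (Fin k → Fin e) λ M →
    (∀ j → c (M j) ≡ j) ×
    (∀ j j' → j ≢ j' → Disjoint E (M j) (M j'))

-- Take k * 2 disjoint copies of the double star with two adjacent centres, each
-- carrying k pendant leaves; so every vertex has degree at most k + 1. In copy c
-- the central edge gets colour 0 and the k * 2 leaf edges get colour c + 1, so each
-- of the k * 2 + 1 colours is used k * 2 times. A full rainbow matching would have
-- to use the central edge of some copy c together with an edge of colour c + 1,
-- but every such edge lies in copy c and meets its central edge.
module Submission where

open import Defs
open import Data.Nat using (ℕ; zero; suc; _+_; _*_; _≤_; _/_; z≤n; s≤s)
open import Data.Nat.Properties using (+-assoc; +-comm; +-identityʳ; *-identityʳ; *-zeroʳ; ≤-reflexive)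
open import Data.Nat.DivMod using (m*n/n≡m)
open import Data.Nat.Divisibility using (_∣_; divides)
open import Data.Fin using (Fin; zero; suc; _↑ˡ_; _↑ʳ_; combine; remQuot; _≟_)
open import Data.Fin.Properties using (suc-injective; ↑ˡ-injective; ↑ʳ-injective; combine-injectiveˡ; combine-injectiveʳ; remQuot-combine; combine-remQuot)
open import Data.Bool using (Bool; true; false; _∨_; if_then_else_)
open import Data.Bool.Properties using (∨-identityʳ)
open import Data.Product using (Σ; ∃; _×_; _,_; proj₁; proj₂; uncurry)
open import Data.Sum using (inj₁; inj₂)
open import Data.Empty using (⊥-elim)
open import Function using (_∘_)
open import Function.Definitions using (Injective)
open import Relation.Nullary using (¬_; yes; no)
open import Relation.Nullary.Decidable using (Dec; ⌊_⌋; isYes≗does; dec-true; dec-false; ⌊⌋-map′)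
open import Relation.Binary.PropositionalEquality
  using (_≡_; _≢_; refl; sym; trans; cong; cong₂; subst)

⌊⌋-yes : ∀ {a} {A : Set a} (a? : Dec A) → A → ⌊ a? ⌋ ≡ true
⌊⌋-yes a? a = trans (isYes≗does a?) (dec-true a? a)

⌊⌋-no : ∀ {a} {A : Set a} (a? : Dec A) → ¬ A → ⌊ a? ⌋ ≡ false
⌊⌋-no a? ¬a = trans (isYes≗does a?) (dec-false a? ¬a)

count-ext : ∀ {n} {p q : Fin n → Bool} → (∀ i → p i ≡ q i) → count p ≡ count q
count-ext {zero}  p≗q = refl
count-ext {suc n} p≗q =
  cong₂ _+_ (cong (λ b → if b then 1 else 0) (p≗q zero)) (count-ext (p≗q ∘ suc))

count-false : ∀ n → count {n} (λ _ → false) ≡ 0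
count-false zero    = refl
count-false (suc n) = count-false n

count-true : ∀ n → count {n} (λ _ → true) ≡ n
count-true zero    = refl
count-true (suc n) = cong suc (count-true n)

count-≟ : ∀ {n} (j : Fin n) → count (λ i → ⌊ i ≟ j ⌋) ≡ 1
count-≟ {suc n} zero    = cong suc (count-false n)
count-≟ {suc n} (suc j) = trans (count-ext (λ i → ⌊⌋-map′ _ _ (i ≟ j))) (count-≟ j)

count-+ : ∀ a b (p : Fin (a + b) → Bool) →
  count p ≡ count (λ i → p (i ↑ˡ b)) + count (λ j → p (a ↑ʳ j))
count-+ zero    b p = refl
count-+ (suc a) b p =
  trans (cong ((if p zero then 1 else 0) +_) (count-+ a b (p ∘ suc)))
        (sym (+-assoc (if p zero then 1 else 0) _ _))

count-combine : ∀ a {b n} (p : Fin (a * b) → Bool) →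
  (∀ x → count (λ y → p (combine {a} {b} x y)) ≡ n) → count p ≡ a * n
count-combine zero        p rows = refl
count-combine (suc a) {b} p rows =
  trans (count-+ b (a * b) p)
        (cong₂ _+_ (rows zero) (count-combine a (λ z → p (b ↑ʳ z)) (rows ∘ suc)))

count-combine-row : ∀ a {b} (p : Fin (a * b) → Bool) (x₀ : Fin a) →
  (∀ x y → x ≢ x₀ → p (combine {a} {b} x y) ≡ false) →
  count p ≡ count (λ y → p (combine {a} {b} x₀ y))
count-combine-row (suc a) {b} p zero off =
  trans (count-+ b (a * b) p)
        (trans (cong (count (λ y → p (combine {suc a} {b} zero y)) +_) rest≡0) (+-identityʳ _))
  where
  rest≡0 : count (λ z → p (b ↑ʳ z)) ≡ 0
  rest≡0 = trans (count-combine a _ (λ x → trans (count-ext (λ y → off (suc x) y λ ()))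
                                                  (count-false b)))
                 (*-zeroʳ a)
count-combine-row (suc a) {b} p (suc x₀) off =
  trans (count-+ b (a * b) p)
        (cong₂ _+_ (trans (count-ext (λ y → off zero y λ ())) (count-false b))
                   (count-combine-row a _ x₀ (λ x y x≢x₀ → off (suc x) y (x≢x₀ ∘ suc-injective))))

remQuot-injective : ∀ {m} n {i j : Fin (m * n)} → remQuot {m} n i ≡ remQuot n j → i ≡ j
remQuot-injective {m} n {i} {j} eq =
  trans (sym (combine-remQuot {m} n i))
        (trans (cong (uncurry combine) eq) (combine-remQuot {m} n j))

≟-injective : ∀ {m n} {f : Fin m → Fin n} → Injective _≡_ _≡_ f →
  ∀ x y → ⌊ f x ≟ f y ⌋ ≡ ⌊ x ≟ y ⌋
≟-injective {f = f} f-inj x y with x ≟ y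
... | yes refl = ⌊⌋-yes (f x ≟ f x) refl
... | no x≢y   = ⌊⌋-no (f x ≟ f y) (x≢y ∘ f-inj)

combine-≟ : ∀ {m n} (c : Fin m) (u v : Fin n) → ⌊ combine c u ≟ combine c v ⌋ ≡ ⌊ u ≟ v ⌋
combine-≟ c = ≟-injective (combine-injectiveʳ c _ c _)

combine-≢-≟ : ∀ {m n} {c c' : Fin m} (u v : Fin n) → c ≢ c' →
  ⌊ combine c u ≟ combine c' v ⌋ ≡ false
combine-≢-≟ {c = c} {c'} u v c≢c' =
  ⌊⌋-no (combine c u ≟ combine c' v) (c≢c' ∘ combine-injectiveˡ c u c' v)

touches : ∀ {n} → Fin n × Fin n → Fin n → Bool
touches e w = ⌊ proj₁ e ≟ w ⌋ ∨ ⌊ proj₂ e ≟ w ⌋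

shared⇒¬Disjoint : ∀ {n e} {E : EdgeList n e} {i j} v →
  incident E v i ≡ true → incident E v j ≡ true → ¬ Disjoint E i j
shared⇒¬Disjoint v v∈i v∈j disjoint with trans (sym v∈j) (disjoint v v∈i)
... | ()

blocked⇒¬FullRainbowMatching : ∀ {n e k} (E : EdgeList n e) (col : Fin e → Fin k)
  (j₀ : Fin k) (block : Fin e → Fin k) →
  (∀ i → j₀ ≢ block i) →
  (∀ i i' → col i ≡ j₀ → col i' ≡ block i → ¬ Disjoint E i i') →
  ¬ FullRainbowMatching E col
blocked⇒¬FullRainbowMatching E col j₀ block j₀≢block meets (pick , pick-col , pick-disjoint) =
  meets i (pick (block i)) (pick-col j₀) (pick-col (block i))
        (pick-disjoint j₀ (block i) (j₀≢block i))
  where i = pick j₀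

liftEdge : ∀ {M n} → Fin M → Fin n × Fin n → Fin (M * n) × Fin (M * n)
liftEdge c e = combine c (proj₁ e) , combine c (proj₂ e)

copies : ∀ M {n e} → EdgeList n e → EdgeList (M * n) (M * e)
copies M {e = e} H i = uncurry (λ c r → liftEdge c (H r)) (remQuot {M} e i)

module _ {M n e : ℕ} {H : EdgeList n e} where

  incident-copies : ∀ {i c r} w → remQuot {M} e i ≡ (c , r) →
    incident (copies M H) (combine {M} c w) i ≡ incident H w r
  incident-copies {c = c} {r} w rq≡ =
    trans (cong (λ cr → touches (uncurry (λ c r → liftEdge c (H r)) cr) (combine c w)) rq≡)
          (cong₂ _∨_ (combine-≟ c (proj₁ (H r)) w) (combine-≟ c (proj₂ (H r)) w))

  incident-copies-≢ : ∀ {c c'} r w → c ≢ c' →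
    incident (copies M H) (combine {M} c' w) (combine {M} c r) ≡ false
  incident-copies-≢ {c} {c'} r w c≢c' =
    trans (cong (λ cr → touches (uncurry (λ c r → liftEdge c (H r)) cr) (combine c' w))
                (remQuot-combine {M} c r))
          (cong₂ _∨_ (combine-≢-≟ (proj₁ (H r)) w c≢c') (combine-≢-≟ (proj₂ (H r)) w c≢c'))

  degree-copies : ∀ c w → degree (copies M H) (combine {M} c w) ≡ degree H w
  degree-copies c w =
    trans (count-combine-row M _ c (λ x r x≢c → incident-copies-≢ r w x≢c))
          (count-ext (λ r → incident-copies w (remQuot-combine {M} c r)))

  copies-maxDegree : ∀ {d} → Fin M → MaxDegree H d → MaxDegree (copies M H) d
  copies-maxDegree {d} c₀ (bounded , w₀ , deg-w₀) =
    copies-bounded , combine c₀ w₀ , trans (degree-copies c₀ w₀) deg-w₀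
    where
    copies-bounded : ∀ v → degree (copies M H) v ≤ d
    copies-bounded v =
      subst (λ v → degree (copies M H) v ≤ d) (combine-remQuot {M} n v)
            (subst (_≤ d) (sym (degree-copies c w)) (bounded w))
      where
      c = proj₁ (remQuot {M} n v)
      w = proj₂ (remQuot {M} n v)

  liftEdge-SamePair : ∀ {c c' : Fin M} {x y : Fin n × Fin n} →
    SamePair (liftEdge c x) (liftEdge c' y) → c ≡ c' × SamePair x y
  liftEdge-SamePair {c} {c'} {u , v} {u' , v'} (inj₁ (u≡u' , v≡v')) =
    combine-injectiveˡ c u c' u' u≡u' ,
    inj₁ (combine-injectiveʳ c u c' u' u≡u' , combine-injectiveʳ c v c' v' v≡v')
  liftEdge-SamePair {c} {c'} {u , v} {u' , v'} (inj₂ (u≡v' , v≡u')) =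
    combine-injectiveˡ c u c' v' u≡v' ,
    inj₂ (combine-injectiveʳ c u c' v' u≡v' , combine-injectiveʳ c v c' u' v≡u')

  copies-simple : IsSimple H → IsSimple (copies M H)
  copies-simple (loopless , parallel-free) = copies-loopless , copies-parallel-free
    where
    copies-loopless : ∀ i → proj₁ (copies M H i) ≢ proj₂ (copies M H i)
    copies-loopless i same = loopless r (combine-injectiveʳ c _ c _ same)
      where
      c = proj₁ (remQuot {M} e i)
      r = proj₂ (remQuot {M} e i)

    copies-parallel-free : ∀ i j → SamePair (copies M H i) (copies M H j) → i ≡ j
    copies-parallel-free i j same with liftEdge-SamePair same
    ... | c≡c' , same' =
      remQuot-injective {M} e (cong₂ _,_ c≡c' (parallel-free _ _ same'))

  copies-bipartite : IsBipartite H → IsBipartite (copies M H)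
  copies-bipartite (side , proper) = copies-side , copies-proper
    where
    copies-side : Fin (M * n) → Bool
    copies-side v = side (proj₂ (remQuot {M} n v))

    copies-side-combine : ∀ c w → copies-side (combine c w) ≡ side w
    copies-side-combine c w = cong (side ∘ proj₂) (remQuot-combine {M} c w)

    copies-proper : ∀ i → copies-side (proj₁ (copies M H i)) ≢ copies-side (proj₂ (copies M H i))
    copies-proper i same =
      proper r (trans (sym (copies-side-combine c (proj₁ (H r))))
                      (trans same (copies-side-combine c (proj₂ (H r)))))
      where
      c = proj₁ (remQuot {M} e i)
      r = proj₂ (remQuot {M} e i)

copyColour : ∀ {M L} → Fin M × Fin (suc L) → Fin (suc M)
copyColour (c , zero)  = zero
copyColour (c , suc _) = suc c

copyColouring : ∀ M L → Fin (M * suc L) → Fin (suc M)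
copyColouring M L = copyColour ∘ remQuot {M} (suc L)

module _ (M L : ℕ) where

  private
    colour-combine : ∀ j c r →
      ⌊ copyColouring M L (combine c r) ≟ j ⌋ ≡ ⌊ copyColour (c , r) ≟ j ⌋
    colour-combine j c r = cong (λ x → ⌊ copyColour x ≟ j ⌋) (remQuot-combine {M} c r)

  colourCount-copyColouring-zero : colourCount (copyColouring M L) zero ≡ M
  colourCount-copyColouring-zero =
    trans (count-combine M _ (λ c → trans (count-ext (colour-combine zero c))
                                          (cong suc (count-false L))))
          (*-identityʳ M)

  colourCount-copyColouring-suc : ∀ c → colourCount (copyColouring M L) (suc c) ≡ L
  colourCount-copyColouring-suc c =
    trans (count-combine-row M _ c (λ x r x≢c → trans (colour-combine (suc c) x r) (other-copy x≢c r)))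
          (trans (count-ext (colour-combine (suc c) c))
                 (trans (count-ext {L} (λ _ → ⌊⌋-yes (suc c ≟ suc c) refl)) (count-true L)))
    where
    other-copy : ∀ {x} → x ≢ c → ∀ r → ⌊ copyColour (x , r) ≟ suc c ⌋ ≡ false
    other-copy x≢c zero    = refl
    other-copy x≢c (suc l) = ⌊⌋-no _ (x≢c ∘ suc-injective)

copyColour-zero : ∀ {M L} (x : Fin M × Fin (suc L)) → copyColour x ≡ zero → x ≡ (proj₁ x , zero)
copyColour-zero (c , zero) _ = refl

copyColour-suc : ∀ {M L} (x : Fin M × Fin (suc L)) c → copyColour x ≡ suc c →
  ∃ λ l → x ≡ (c , suc l)
copyColour-suc (c , suc l) c refl = l , refl

copies-¬FullRainbowMatching : ∀ M {n L} (H : EdgeList n (suc L)) →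
  (∀ l → ∃ λ v → incident H v zero ≡ true × incident H v (suc l) ≡ true) →
  ¬ FullRainbowMatching (copies M H) (copyColouring M L)
copies-¬FullRainbowMatching M {n} {L} H meets-central =
  blocked⇒¬FullRainbowMatching (copies M H) (copyColouring M L) zero (suc ∘ copy) (λ _ ()) meets
  where
  copy : Fin (M * suc L) → Fin M
  copy i = proj₁ (remQuot {M} (suc L) i)

  meets : ∀ i i' → copyColouring M L i ≡ zero → copyColouring M L i' ≡ suc (copy i) →
    ¬ Disjoint (copies M H) i i'
  meets i i' central-i coloured-i'
    with copyColour-zero (remQuot {M} (suc L) i) central-i
       | copyColour-suc (remQuot {M} (suc L) i') (copy i) coloured-i'
  ... | rq-i | l , rq-i' with meets-central l
  ... | v , v∈central , v∈l =
    shared⇒¬Disjoint {E = copies M H} {i} {i'} (combine (copy i) v)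
      (trans (incident-copies {H = H} v rq-i) v∈central)
      (trans (incident-copies {H = H} v rq-i') v∈l)

count-remainder : ∀ k {n} (b : Fin n) → count (λ l → ⌊ proj₂ (remQuot {k} n l) ≟ b ⌋) ≡ k
count-remainder k {n} b =
  trans (count-combine k _ (λ a → trans (count-ext (λ b' → cong (λ x → ⌊ proj₂ x ≟ b ⌋)
                                                                 (remQuot-combine {k} a b')))
                                        (count-≟ b)))
        (*-identityʳ k)

centre : ∀ {n} → Fin 2 → Fin (2 + n)
centre b = b ↑ˡ _

leaf : ∀ {n} → Fin n → Fin (2 + n)
leaf l = 2 ↑ʳ l

centre≢leaf : ∀ {n} b (l : Fin n) → centre b ≢ leaf l
centre≢leaf zero       l ()
centre≢leaf (suc zero) l ()

-- The leaf combine a b, with a : Fin k, hangs off centre b.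
owner : ∀ {k} → Fin (k * 2) → Fin 2
owner {k} l = proj₂ (remQuot {k} 2 l)

doubleStar : ∀ k → EdgeList (2 + k * 2) (suc (k * 2))
doubleStar k zero    = centre zero , centre (suc zero)
doubleStar k (suc l) = centre (owner {k} l) , leaf l

module _ (k : ℕ) where

  private
    H = doubleStar k

  centre-on-central : ∀ b → incident H (centre b) zero ≡ true
  centre-on-central zero       = refl
  centre-on-central (suc zero) = ⌊⌋-yes (centre {k * 2} (suc zero) ≟ centre (suc zero)) refl

  centre-on-spoke : ∀ b l → incident H (centre b) (suc l) ≡ ⌊ owner {k} l ≟ b ⌋
  centre-on-spoke b l =
    trans (cong₂ _∨_ (≟-injective (↑ˡ-injective (k * 2) _ _) (owner {k} l) b)
                     (⌊⌋-no (leaf l ≟ centre b) (centre≢leaf b l ∘ sym)))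
          (∨-identityʳ _)

  leaf-on-spoke : ∀ l l' → incident H (leaf l) (suc l') ≡ ⌊ l' ≟ l ⌋
  leaf-on-spoke l l' =
    trans (cong (_∨ ⌊ leaf l' ≟ leaf l ⌋)
                (⌊⌋-no (centre (owner {k} l') ≟ leaf l) (centre≢leaf (owner {k} l') l)))
          (≟-injective (↑ʳ-injective 2 _ _) l' l)

  degree-centre : ∀ b → degree H (centre b) ≡ suc k
  degree-centre b =
    cong₂ _+_ (cong (λ t → if t then 1 else 0) (centre-on-central b))
              (trans (count-ext (centre-on-spoke b)) (count-remainder k b))

  degree-leaf : ∀ l → degree H (leaf l) ≡ 1
  degree-leaf l =
    cong₂ _+_ (cong (λ t → if t then 1 else 0) (⌊⌋-no (suc zero ≟ leaf l) λ ()))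
              (trans (count-ext (leaf-on-spoke l)) (count-≟ l))

  doubleStar-maxDegree : MaxDegree H (suc k)
  doubleStar-maxDegree = bounded , zero , degree-centre zero
    where
    bounded : ∀ v → degree H v ≤ suc k
    bounded zero          = ≤-reflexive (degree-centre zero)
    bounded (suc zero)    = ≤-reflexive (degree-centre (suc zero))
    bounded (suc (suc l)) = subst (_≤ suc k) (sym (degree-leaf l)) (s≤s z≤n)

  doubleStar-simple : IsSimple H
  doubleStar-simple = loopless , parallel-free
    where
    loopless : ∀ i → proj₁ (H i) ≢ proj₂ (H i)
    loopless zero    ()
    loopless (suc l) = centre≢leaf (owner {k} l) l

    parallel-free : ∀ i j → SamePair (H i) (H j) → i ≡ j
    parallel-free zero    zero     _                  = refl
    parallel-free zero    (suc l)  (inj₁ (_ , ()))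
    parallel-free zero    (suc l)  (inj₂ (() , _))
    parallel-free (suc l) zero     (inj₁ (_ , ()))
    parallel-free (suc l) zero     (inj₂ (_ , ()))
    parallel-free (suc l) (suc l') (inj₁ (_ , same))  = cong suc (↑ʳ-injective 2 l l' same)
    parallel-free (suc l) (suc l') (inj₂ (same , _))  = ⊥-elim (centre≢leaf _ l' same)

  doubleStar-bipartite : IsBipartite H
  doubleStar-bipartite = side , proper
    where
    side : Fin (2 + k * 2) → Bool
    side zero          = false
    side (suc zero)    = true
    side (suc (suc l)) = ⌊ owner {k} l ≟ zero ⌋

    centre-side : ∀ b → side (centre b) ≢ ⌊ b ≟ zero ⌋
    centre-side zero       ()
    centre-side (suc zero) ()

    proper : ∀ i → side (proj₁ (H i)) ≢ side (proj₂ (H i))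
    proper zero    ()
    proper (suc l) = centre-side (owner {k} l)

  central-meets-spoke : ∀ l → ∃ λ v → incident H v zero ≡ true × incident H v (suc l) ≡ true
  central-meets-spoke l =
    centre (owner {k} l) ,
    centre-on-central (owner {k} l) ,
    trans (centre-on-spoke (owner {k} l) l) (⌊⌋-yes (owner {k} l ≟ owner {k} l) refl)

RainbowCounterexample : ℕ → ℕ → Set
RainbowCounterexample m Δ =
  Σ ℕ λ n → Σ ℕ λ e → Σ (EdgeList n e) λ E →
    IsSimple E × IsBipartite E ×
    Σ (Fin e → Fin (suc m)) λ c →
      (∀ k → colourCount c k ≡ m) ×
      MaxDegree E Δ ×
      ¬ FullRainbowMatching E c

doubleStarCopies-counterexample : ∀ k → RainbowCounterexample (suc k * 2) (suc (suc k))
doubleStarCopies-counterexample k =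
  _ , _ , copies M H ,
  copies-simple {M} {H = H} (doubleStar-simple K) ,
  copies-bipartite {M} {H = H} (doubleStar-bipartite K) ,
  copyColouring M M ,
  (λ { zero    → colourCount-copyColouring-zero M M
     ; (suc c) → colourCount-copyColouring-suc M M c }) ,
  copies-maxDegree {M} {H = H} zero (doubleStar-maxDegree K) ,
  copies-¬FullRainbowMatching M H (central-meets-spoke K)
  where
  K = suc k
  M = K * 2
  H = doubleStar K

-- The construction works for every even m ≥ 2; the bound 4 ≤ m only excludes m = 0.
mainTheorem5 : (m : ℕ) → 4 ≤ m → 2 ∣ m →
    Σ ℕ λ n → Σ ℕ λ e → Σ (EdgeList n e) λ E →
      IsSimple E × IsBipartite E ×
      Σ (Fin e → Fin (suc m)) λ c →
        (∀ k → colourCount c k ≡ m) ×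
        MaxDegree E (m / 2 + 1) ×
        ¬ FullRainbowMatching E c
mainTheorem5 _ () (divides zero refl)
mainTheorem5 _ _  (divides (suc q) refl) =
  subst (RainbowCounterexample (suc q * 2)) half+1 (doubleStarCopies-counterexample q)
  where
  half+1 : suc (suc q) ≡ suc q * 2 / 2 + 1
  half+1 = trans (+-comm 1 (suc q)) (cong (_+ 1) (sym (m*n/n≡m (suc q) 2)))
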